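{- Let $\mu:G\times H\to K$ be a graph homomorphism, where $K$ is square-free and $G$ and $H$ are connected and non-bipartite. Suppose $\mu$ has no $H$-extremal sets, and suppose $R\in\pi_{\mu(g_0,h_0)}(K)$ is such that for every closed walk $C$ from $(g_0,h_0)$ in $G\times H$, $\overline{\mu(C)}=R^{i}$ for some $i\in\mathbb{Z}$. If $\mu$ is not constant on $V(G)\times\{h\}$ for any $h\in V(H)$, then $R$ is cyclically reduced.
   Context: All graphs are finite, simple, loopless; every graph has at least two vertices and no isolated vertices. $G\times H$ is the tensor product (vertices $V(G)\times V(H)$, $(g,h)(g',h')$ an edge iff $gg'\in E(G)$ and $hh'\in E(H)$); $G\times h_0h_1$ is the subgraph induced by $V(G)\times\{h_0,h_1\}$. Square-free: no four pairwise distinct vertices $v_1,\dots,v_4$ with $v_1v_2,v_2v_3,v_3v_4,v_4v_1$ edges. $N_F(S)$ is the set of neighbors of vertices of $S$ in $F$, $N^2_F(S)=N_F(N_F(S))\setminus S$. An $H$-extremal set for $\mu$ is a pair $(S,h_0h_1)$ with $h_0h_1$ an oriented edge of $H$ and $S\subseteq V(G)\times\{h_1\}$ such that for some $a,b\in V(K)$: $\mu(S)=\{a\}$, $\mu(N_{G\times h_0h_1}(S))=\{b\}$, $N^2_{G\times h_0h_1}(S)\ne\emptyset$, and $a\notin\mu(N^2_{G\times h_0h_1}(S))$. A walk is a sequence of oriented edges each starting where the previous ends; $\overline{W}$ is the reduced walk obtained by repeatedly deleting consecutive pairs $e,e^{ -1}$ (a walk is reduced if it has no such pair). $\pi_v(K)$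 is the group of closed reduced walks from $v$ with product $W\cdot W'=\overline{WW'}$, and $R^i$ its powers. A closed reduced walk $R$ is cyclically reduced if the concatenation $RR$ is reduced. -}

module Defs where

open import Data.Nat using (ℕ; zero; suc; _≤_)
open import Data.Integer using (ℤ; +_; -[1+_])
open import Data.Fin using (Fin) renaming (_≟_ to _≟F_)
open import Data.Fin.Subset using (Subset; _∈_)
open import Data.Bool using (Bool; true; false)
open import Data.List using (List; []; _∷_; _++_; drop; reverse; foldl)
open import Data.Product using (Σ; ∃; _×_; _,_; proj₁; proj₂)
open import Data.Sum using (_⊎_)
open import Data.Unit using (⊤)
open import Data.Empty using (⊥)
open import Relation.Nullary using (¬_; yes; no)
open import Relation.Binary.PropositionalEquality using (_≡_; _≢_)

record Graph : Set where
  field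
    n      : ℕ
    adj    : Fin n → Fin n → Bool
    sym    : ∀ u v → adj u v ≡ adj v u
    irrefl : ∀ u → adj u u ≡ false
    two    : 2 ≤ n
    noIso  : ∀ u → ∃ λ v → adj u v ≡ true

  V : Set
  V = Fin n

  E : V → V → Set
  E u v = adj u v ≡ true

open Graph public

-- Walks, given as their full vertex sequences (v₀ ∷ v₁ ∷ … ∷ vₖ).
-- In a simple loopless graph an oriented-edge walk is determined by its
-- vertex sequence, and a consecutive pair e, e⁻¹ corresponds to vᵢ ≡ vᵢ₊₂.

module _ {A : Set} (R : A → A → Set) where

  Path : A → List A → Set
  Path u []       = ⊤
  Path u (w ∷ ws) = R u w × Path w ws

  WalkFrom : A → List A → Set
  WalkFrom v []       = ⊥
  WalkFrom v (x ∷ xs) = x ≡ v × Path x xs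

end : {A : Set} → A → List A → A
end d []       = d
end d (x ∷ xs) = end x xs

ClosedWalkFrom : {A : Set} (R : A → A → Set) → A → List A → Set
ClosedWalkFrom R v W = WalkFrom R v W × end v W ≡ v

Reduced : {A : Set} → List A → Set
Reduced (x ∷ y ∷ z ∷ r) = x ≢ z × Reduced (y ∷ z ∷ r)
Reduced _               = ⊤

-- Free reduction W ↦ W̄ (stack-based deletion of backtracks), on Fin k.

module _ {k : ℕ} where

  push : List (Fin k) → Fin k → List (Fin k)
  push (x ∷ y ∷ s) w with w ≟F y
  ... | yes _ = y ∷ s
  ... | no  _ = w ∷ x ∷ y ∷ s
  push s w = w ∷ s

  reduce : List (Fin k) → List (Fin k)
  reduce W = reverse (foldl push [] W)

  _·_ : List (Fin k) → List (Fin k) → List (Fin k)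
  W · W' = reduce (W ++ drop 1 W')

  powℕ : Fin k → List (Fin k) → ℕ → List (Fin k)
  powℕ v W zero    = v ∷ []
  powℕ v W (suc m) = W · powℕ v W m

  pow : Fin k → List (Fin k) → ℤ → List (Fin k)
  pow v R (+ m)      = powℕ v R m
  pow v R -[1+ m ]   = powℕ v (reverse R) (suc m)

InPi : (K : Graph) → V K → List (V K) → Set
InPi K v R = ClosedWalkFrom (E K) v R × Reduced R

CyclicallyReduced : {A : Set} → List A → Set
CyclicallyReduced R = Reduced R × Reduced (R ++ drop 1 R)

Connected : Graph → Set
Connected G = ∀ u v → ∃ λ W → WalkFrom (E G) u W × end u W ≡ v

Bipartite : Graph → Set
Bipartite G = ∃ λ (c : V G → Bool) → ∀ u v → E G u v → c u ≢ c v

SquareFree : Graph → Set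
SquareFree K = ¬ (∃ λ v₁ → ∃ λ v₂ → ∃ λ v₃ → ∃ λ v₄ →
  (v₁ ≢ v₂ × v₁ ≢ v₃ × v₁ ≢ v₄ × v₂ ≢ v₃ × v₂ ≢ v₄ × v₃ ≢ v₄) ×
  (E K v₁ v₂ × E K v₂ v₃ × E K v₃ v₄ × E K v₄ v₁))

TensorE : (G H : Graph) → V G × V H → V G × V H → Set
TensorE G H (g , h) (g' , h') = E G g g' × E H h h'

IsHom : (G H K : Graph) → (V G × V H → V K) → Set
IsHom G H K μ = ∀ x y → TensorE G H x y → E K (μ x) (μ y)

module _ (G H : Graph) (h₀ h₁ : V H) where

  InLayer : V G × V H → Set
  InLayer (g , h) = h ≡ h₀ ⊎ h ≡ h₁

  LayerE : V G × V H → V G × V H → Set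
  LayerE x y = InLayer x × InLayer y × TensorE G H x y

  Nbhd : (V G × V H → Set) → V G × V H → Set
  Nbhd S y = ∃ λ x → S x × LayerE x y

  Nbhd2 : (V G × V H → Set) → V G × V H → Set
  Nbhd2 S z = Nbhd (Nbhd S) z × ¬ S z

Lift : (G H : Graph) → Subset (n G) → V H → V G × V H → Set
Lift G H S h₁ (g , h) = g ∈ S × h ≡ h₁

IsHExtremal : (G H K : Graph) → (V G × V H → V K) →
              Subset (n G) → V H → V H → Set
IsHExtremal G H K μ S h₀ h₁ =
  E H h₀ h₁ × ∃ λ a → ∃ λ b →
    ((∃ λ x → S' x) × (∀ x → S' x → μ x ≡ a)) ×
    ((∃ λ y → Nbhd G H h₀ h₁ S' y) × (∀ y → Nbhd G H h₀ h₁ S' y → μ y ≡ b)) ×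
    (∃ λ z → Nbhd2 G H h₀ h₁ S' z) ×
    (∀ z → Nbhd2 G H h₀ h₁ S' z → μ z ≢ a)
  where
    S' : V G × V H → Set
    S' = Lift G H S h₁

NoHExtremal : (G H K : Graph) → (V G × V H → V K) → Set
NoHExtremal G H K μ = ∀ S h₀ h₁ → ¬ IsHExtremal G H K μ S h₀ h₁

module Submission where

-- Let v = μ(g₀,h₀) and suppose the reduced closed walk R is not cyclically reduced.
-- Peeling matching first and last edges off R writes R = U C U⁻¹ with U = v … non-trivial and C a
-- cyclically reduced cycle, so every power Rⁱ is trivial or a reduced walk leaving v towards w and
-- returning from w, w the second vertex of R ("flanked").  Free reduction is a stack machine; call
-- the stack of the image of a walk from (g₀,h₀) admissible if its reduced image does not leave v
-- towards w.  Since closed walks W₁W₂⁻¹ map to flanked powers, a vertex carries at most one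
-- admissible stack, so by pigeonhole admissible stacks have boundedly many lengths.  But for an
-- admissible stack s of maximal length at (g₁,h₁), the set S of all g with (g,h₁) carrying s has, in
-- G × h₀h₁, μ(S) = {a}, μ(N(S)) = {b} and a ∉ μ(N²(S)); as there are no H-extremal sets N²(S) = ∅,
-- and G connected and non-bipartite then forces S = V(G), making μ constant on V(G) × {h₁}.  Thus
-- stacks of all lengths exist (up to double negation, enough as the goal is ⊥): a contradiction.

open import Defs renaming (sym to adj-sym)
open import Data.Empty using (⊥; ⊥-elim)
open import Data.Fin using (Fin; toℕ; combine; zero; suc; _<_)
open import Data.Fin.Properties using (all?; pigeonhole; combine-injective) renaming (_≟_ to _≟F_)
open import Data.Fin.Subset using (Subset; _∈_)
open import Data.Fin.Subset.Properties using (_∈?_)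
open import Data.Integer using (ℤ; +_; -[1+_])
open import Data.List using (List; []; _∷_; _++_; _∷ʳ_; drop; reverse; foldl; map; length; initLast; _∷ʳ′_)
open import Data.List.Properties
  using (++-assoc; ++-identityʳ; reverse-++; reverse-involutive; reverse-map; unfold-reverse; foldl-++;
         map-++; ∷-injectiveˡ; ∷-injectiveʳ; length-++-≤ˡ)
open import Data.List.Reverse using (Reverse; []; _∶_∶ʳ_; reverseView)
open import Data.Nat using (ℕ; zero; suc; _≤_; s≤s; _*_)
open import Data.Nat.Properties using (≤-refl; ≤-trans; n<1+n; <-irrefl; suc-injective)
open import Data.Product using (∃; ∃₂; _×_; _,_; proj₁; proj₂)
open import Data.Sum using (_⊎_; inj₁; inj₂)
open import Data.Unit using (tt)
open import Data.Vec using (tabulate)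
open import Data.Vec.Properties using (lookup⇒[]=; []=⇒lookup; lookup∘tabulate)
open import Relation.Binary.Definitions using (DecidableEquality)
open import Relation.Nullary using (¬_; Dec; yes; no; does)
open import Relation.Nullary.Decidable using (decidable-stable; ¬¬-excluded-middle)
open import Relation.Binary.PropositionalEquality

module _ {A : Set} where

  end-++ : ∀ (d : A) P Q → end d (P ++ Q) ≡ end (end d P) Q
  end-++ d []      Q = refl
  end-++ d (x ∷ P) Q = end-++ x P Q

  end-snoc : ∀ (d : A) Z e → end d (Z ++ e ∷ []) ≡ e
  end-snoc d Z e = end-++ d Z (e ∷ [])

  reverse-head : ∀ (x : A) P → ∃ λ rest → reverse (x ∷ P) ≡ end x P ∷ rest
  reverse-head x []      = [] , refl
  reverse-head x (y ∷ P) with reverse-head y P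
  ... | rest , eq = rest ++ x ∷ [] , trans (unfold-reverse x (y ∷ P)) (cong (_++ x ∷ []) eq)

  end-reverse : ∀ (d x : A) P → end d (reverse (x ∷ P)) ≡ x
  end-reverse d x P = trans (cong (end d) (unfold-reverse x P)) (end-snoc d (reverse P) x)

  reverse-∷∷ : ∀ (x y : A) r → reverse (x ∷ y ∷ r) ≡ reverse r ++ y ∷ x ∷ []
  reverse-∷∷ x y r = begin
    reverse (x ∷ y ∷ r)            ≡⟨ unfold-reverse x (y ∷ r) ⟩
    reverse (y ∷ r) ++ x ∷ []      ≡⟨ cong (_++ x ∷ []) (unfold-reverse y r) ⟩
    (reverse r ++ y ∷ []) ++ x ∷ [] ≡⟨ ++-assoc (reverse r) (y ∷ []) (x ∷ []) ⟩
    reverse r ++ y ∷ x ∷ []        ∎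
    where open ≡-Reasoning

  drop1-reverse-∷ : ∀ (x : A) s h rest → reverse s ≡ h ∷ rest → drop 1 (reverse (x ∷ s)) ≡ rest ++ x ∷ []
  drop1-reverse-∷ x s h rest eq = cong (drop 1) (trans (unfold-reverse x s) (cong (_++ x ∷ []) eq))

  end-retrace : ∀ (x : A) P → end (end x P) (drop 1 (reverse (x ∷ P))) ≡ x
  end-retrace x P with reverse-head x P
  ... | rest , eq = trans (cong (λ t → end (end x P) (drop 1 t)) eq)
                          (trans (cong (end (end x P)) (sym eq)) (end-reverse (end x P) x P))

  reverse-conjugate : ∀ (U X : List A) → reverse (U ++ X ++ reverse U) ≡ U ++ reverse X ++ reverse U
  reverse-conjugate U X = begin
    reverse (U ++ X ++ reverse U)              ≡⟨ reverse-++ U (X ++ reverse U) ⟩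
    reverse (X ++ reverse U) ++ reverse U      ≡⟨ cong (_++ reverse U) (reverse-++ X (reverse U)) ⟩
    (reverse (reverse U) ++ reverse X) ++ reverse U
                                               ≡⟨ cong (λ t → (t ++ reverse X) ++ reverse U) (reverse-involutive U) ⟩
    (U ++ reverse X) ++ reverse U              ≡⟨ ++-assoc U (reverse X) (reverse U) ⟩
    U ++ reverse X ++ reverse U                ∎
    where open ≡-Reasoning

  ∷ʳ-two-prefix : ∀ (xs : List A) u p q Y → xs ∷ʳ u ≡ p ∷ q ∷ Y →
                  (xs ≡ p ∷ [] × u ≡ q) ⊎ ∃ λ Y' → xs ≡ p ∷ q ∷ Y'
  ∷ʳ-two-prefix []          u p q Y ()
  ∷ʳ-two-prefix (a ∷ [])     u p q Y refl = inj₁ (refl , refl)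
  ∷ʳ-two-prefix (a ∷ b ∷ xs) u p q Y refl = inj₂ (xs , refl)

module _ {A : Set} (Adj : A → A → Set) where

  path-++ : ∀ u P Q → Path Adj u P → Path Adj (end u P) Q → Path Adj u (P ++ Q)
  path-++ u []      Q _        q = q
  path-++ u (x ∷ P) Q (r , p) q = r , path-++ x P Q p q

  path-prefix : ∀ u P Q → Path Adj u (P ++ Q) → Path Adj u P
  path-prefix u []      Q _       = tt
  path-prefix u (x ∷ P) Q (r , p) = r , path-prefix x P Q p

  path-reverse : (∀ a b → Adj a b → Adj b a) →
                 ∀ u P → Path Adj u P → Path Adj (end u P) (drop 1 (reverse (u ∷ P)))
  path-reverse sym-adj u []      _       = tt
  path-reverse sym-adj u (x ∷ P) (r , p) with reverse-head x P
  ... | rest , eq = subst (Path Adj (end x P)) (sym drop-eq)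
                      (path-++ (end x P) rest (u ∷ [])
                        (subst (Path Adj (end x P)) (cong (drop 1) eq) (path-reverse sym-adj x P p))
                        (subst (λ t → Adj t u) (sym end-eq) (sym-adj u x r) , tt))
    where
      drop-eq : drop 1 (reverse (u ∷ x ∷ P)) ≡ rest ++ u ∷ []
      drop-eq = cong (drop 1) (trans (unfold-reverse u (x ∷ P)) (cong (_++ u ∷ []) eq))
      end-eq : end (end x P) rest ≡ x
      end-eq = trans (sym (cong (end x) eq)) (end-reverse x x P)

  walk-transport : (Pr : A → Set) → (∀ a b → Adj a b → Pr a → Pr b) →
                   ∀ x W → WalkFrom Adj x W → Pr x → Pr (end x W)
  walk-transport Pr step x (.x ∷ L) (refl , p) = along x L p
    where
      along : ∀ y L → Path Adj y L → Pr y → Pr (end y L)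
      along y []      _        py = py
      along y (z ∷ L) (r , p) py = along z L p (step y z r py)

module _ {A B : Set} (f : A → B) where

  end-map : ∀ d L → end (f d) (map f L) ≡ f (end d L)
  end-map d []      = refl
  end-map d (x ∷ L) = end-map x L

  map-drop1 : ∀ L → map f (drop 1 L) ≡ drop 1 (map f L)
  map-drop1 []      = refl
  map-drop1 (x ∷ L) = refl

  map-retrace : ∀ x P Q → map f (x ∷ P ++ drop 1 (reverse (x ∷ Q))) ≡ (f x ∷ map f P) ++ drop 1 (reverse (f x ∷ map f Q))
  map-retrace x P Q = begin
    map f ((x ∷ P) ++ drop 1 (reverse (x ∷ Q)))             ≡⟨ map-++ f (x ∷ P) (drop 1 (reverse (x ∷ Q))) ⟩
    map f (x ∷ P) ++ map f (drop 1 (reverse (x ∷ Q)))       ≡⟨ cong (map f (x ∷ P) ++_) (map-drop1 (reverse (x ∷ Q))) ⟩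
    map f (x ∷ P) ++ drop 1 (map f (reverse (x ∷ Q)))       ≡⟨ cong (λ t → map f (x ∷ P) ++ drop 1 t) (reverse-map f (x ∷ Q)) ⟩
    map f (x ∷ P) ++ drop 1 (reverse (f x ∷ map f Q))       ∎
    where open ≡-Reasoning

module _ {A : Set} where

  reduced-tail : ∀ {x : A} {xs} → Reduced (x ∷ xs) → Reduced xs
  reduced-tail {xs = []}        _       = tt
  reduced-tail {xs = _ ∷ []}    _       = tt
  reduced-tail {xs = _ ∷ _ ∷ _} (_ , r) = r

  reduced-prefix : ∀ (P Q : List A) → Reduced (P ++ Q) → Reduced P
  reduced-prefix []              Q _        = tt
  reduced-prefix (a ∷ [])        Q _        = tt
  reduced-prefix (a ∷ b ∷ [])    Q _        = tt
  reduced-prefix (a ∷ b ∷ c ∷ P) Q (ne , r) = ne , reduced-prefix (b ∷ c ∷ P) Q r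

  reduced-suffix : ∀ (P Q : List A) → Reduced (P ++ Q) → Reduced Q
  reduced-suffix []      Q r = r
  reduced-suffix (a ∷ P) Q r = reduced-suffix P Q (reduced-tail r)

  reduced-middle : ∀ (P : List A) x y z Q → Reduced (P ++ x ∷ y ∷ z ∷ Q) → x ≢ z
  reduced-middle []      x y z Q (ne , _) = ne
  reduced-middle (a ∷ P) x y z Q r        = reduced-middle P x y z Q (reduced-tail r)

  reduced-glue : ∀ (P : List A) x y Q → Reduced (P ++ x ∷ y ∷ []) → Reduced (x ∷ y ∷ Q) →
                 Reduced (P ++ x ∷ y ∷ Q)
  reduced-glue []              x y Q _        r = r
  reduced-glue (a ∷ [])        x y Q (ne , _) r = ne , r
  reduced-glue (a ∷ b ∷ [])    x y Q (ne , p) r = ne , reduced-glue (b ∷ []) x y Q p r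
  reduced-glue (a ∷ b ∷ c ∷ P) x y Q (ne , p) r = ne , reduced-glue (b ∷ c ∷ P) x y Q p r

  reduced-reverse : ∀ (xs : List A) → Reduced xs → Reduced (reverse xs)
  reduced-reverse []              _        = tt
  reduced-reverse (x ∷ [])        _        = tt
  reduced-reverse (x ∷ y ∷ [])    _        = tt
  reduced-reverse (x ∷ y ∷ z ∷ r) (ne , p) =
    subst Reduced (sym reverse-eq)
      (reduced-glue (reverse r) z y (x ∷ [])
        (subst Reduced (reverse-∷∷ y z r) (reduced-reverse (y ∷ z ∷ r) p))
        ((λ e → ne (sym e)) , tt))
    where
      open ≡-Reasoning
      reverse-eq : reverse (x ∷ y ∷ z ∷ r) ≡ reverse r ++ z ∷ y ∷ x ∷ []
      reverse-eq = begin
        reverse (x ∷ y ∷ z ∷ r)              ≡⟨ unfold-reverse x (y ∷ z ∷ r) ⟩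
        reverse (y ∷ z ∷ r) ++ x ∷ []        ≡⟨ cong (_++ x ∷ []) (reverse-∷∷ y z r) ⟩
        (reverse r ++ z ∷ y ∷ []) ++ x ∷ []  ≡⟨ ++-assoc (reverse r) (z ∷ y ∷ []) (x ∷ []) ⟩
        reverse r ++ z ∷ y ∷ x ∷ []          ∎

  reduced? : DecidableEquality A → (xs : List A) → Dec (Reduced xs)
  reduced? _≟_ []          = yes tt
  reduced? _≟_ (x ∷ [])     = yes tt
  reduced? _≟_ (x ∷ y ∷ []) = yes tt
  reduced? _≟_ (x ∷ y ∷ z ∷ xs) with x ≟ z | reduced? _≟_ (y ∷ z ∷ xs)
  ... | yes x≡z | _      = no (λ r → proj₁ r x≡z)
  ... | no x≢z  | yes r  = yes (x≢z , r)
  ... | no _    | no ¬r  = no (λ r → ¬r (proj₂ r))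

module _ {A : Set} where

  cycle : A → A → List A → List A
  cycle c c₁ M = c ∷ c₁ ∷ M ++ c ∷ []

  conjugate : List A → List A → List A
  conjugate U X = U ++ X ++ reverse U

  reverse-closed : ∀ (c : A) X → reverse (c ∷ X ++ c ∷ []) ≡ c ∷ reverse X ++ c ∷ []
  reverse-closed c X = trans (unfold-reverse c (X ++ c ∷ [])) (cong (_++ c ∷ []) (reverse-++ X (c ∷ [])))

  reverse-cycle : ∀ (c c₁ : A) M → ∃ λ c₁′ → ∃ λ M′ → reverse (cycle c c₁ M) ≡ cycle c c₁′ M′
  reverse-cycle c c₁ M with reverse-head c₁ M
  ... | rest , eq = end c₁ M , rest , trans (reverse-closed c (c₁ ∷ M)) (cong (λ t → c ∷ t ++ c ∷ []) eq)

  cyclically-reduced-reverse : ∀ (c : A) X → CyclicallyReduced (c ∷ X ++ c ∷ []) →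
                               CyclicallyReduced (reverse (c ∷ X ++ c ∷ []))
  cyclically-reduced-reverse c X (r , rr) =
    reduced-reverse _ r ,
    subst (λ D → Reduced (D ++ drop 1 D)) (sym (reverse-closed c X))
      (subst Reduced twice (reduced-reverse _ rr))
    where
      open ≡-Reasoning
      twice : reverse ((c ∷ X ++ c ∷ []) ++ X ++ c ∷ []) ≡
              (c ∷ reverse X ++ c ∷ []) ++ reverse X ++ c ∷ []
      twice = begin
        reverse ((c ∷ X ++ c ∷ []) ++ X ++ c ∷ [])
          ≡⟨ reverse-++ (c ∷ X ++ c ∷ []) (X ++ c ∷ []) ⟩
        reverse (X ++ c ∷ []) ++ reverse (c ∷ X ++ c ∷ [])
          ≡⟨ cong₂ _++_ (reverse-++ X (c ∷ [])) (reverse-closed c X) ⟩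
        c ∷ reverse X ++ c ∷ reverse X ++ c ∷ []
          ≡⟨ cong (c ∷_) (++-assoc (reverse X) (c ∷ []) (reverse X ++ c ∷ [])) ⟨
        (c ∷ reverse X ++ c ∷ []) ++ reverse X ++ c ∷ []
          ∎

  cyclically-reduced-junction : ∀ (x b : A) Y b′ → Reduced (cycle x b (Y ∷ʳ b′)) → b′ ≢ b →
                                CyclicallyReduced (cycle x b (Y ∷ʳ b′))
  cyclically-reduced-junction x b Y b′ r b′≢b =
    r , subst Reduced (sym (split (b ∷ (Y ∷ʳ b′) ++ x ∷ [])))
          (reduced-glue (x ∷ b ∷ Y) b′ x _ (subst Reduced (split []) (subst Reduced (sym (++-identityʳ _)) r)) (b′≢b , r))
    where
      split : ∀ Z → cycle x b (Y ∷ʳ b′) ++ Z ≡ (x ∷ b ∷ Y) ++ b′ ∷ x ∷ Z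
      split Z = cong (λ t → x ∷ b ∷ t) (trans (++-assoc (Y ∷ʳ b′) (x ∷ []) Z) (++-assoc Y (b′ ∷ []) (x ∷ Z)))

  reduced-insert : ∀ (P Y : List A) a b T Q W → Y ++ a ∷ b ∷ T ≡ a ∷ b ∷ W →
                   Reduced (P ++ a ∷ b ∷ T ++ Q) → Reduced (Y ++ a ∷ b ∷ T) →
                   Reduced (P ++ (Y ++ a ∷ b ∷ T) ++ Q)
  reduced-insert P Y a b T Q W eq rPXQ rYX =
    subst (λ Z → Reduced (P ++ Z ++ Q)) (sym eq)
      (reduced-glue P a b (W ++ Q) left
        (subst (λ Z → Reduced (Z ++ Q)) eq
          (subst Reduced (sym (++-assoc Y (a ∷ b ∷ T) Q))
            (reduced-glue Y a b (T ++ Q) (junction Y T rYX) (reduced-suffix P _ rPXQ)))))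
    where
      junction : ∀ Z T → Reduced (Z ++ a ∷ b ∷ T) → Reduced (Z ++ a ∷ b ∷ [])
      junction Z T r = reduced-prefix (Z ++ a ∷ b ∷ []) T (subst Reduced (sym (++-assoc Z (a ∷ b ∷ []) T)) r)
      left : Reduced (P ++ a ∷ b ∷ [])
      left = junction P (T ++ Q) rPXQ

  Flanked : A → A → List A → Set
  Flanked v w E = Reduced E ×
    (E ≡ v ∷ [] ⊎ (∃ λ Z₁ → E ≡ v ∷ w ∷ Z₁) × (∃ λ Z₂ → E ≡ Z₂ ++ w ∷ v ∷ []))

  firstStep : List A → A → A
  firstStep []      c = c
  firstStep (a ∷ _) c = a

  conjugate-flanked : ∀ (v : A) as c X Z → Reduced (conjugate (v ∷ as) (c ∷ X)) → c ∷ X ≡ Z ++ c ∷ [] →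
                      Flanked v (firstStep as c) (conjugate (v ∷ as) (c ∷ X))
  conjugate-flanked v []        c X Z r eq =
    r , inj₂ ((_ , refl) , v ∷ Z , cong (v ∷_) (trans (cong (_++ v ∷ []) eq) (++-assoc Z (c ∷ []) (v ∷ []))))
  conjugate-flanked v (a ∷ as) c X Z r eq =
    r , inj₂ ((_ , refl) , (v ∷ a ∷ as) ++ (c ∷ X) ++ reverse as , ends)
    where
      open ≡-Reasoning
      ends : conjugate (v ∷ a ∷ as) (c ∷ X) ≡ ((v ∷ a ∷ as) ++ (c ∷ X) ++ reverse as) ++ a ∷ v ∷ []
      ends = begin
        (v ∷ a ∷ as) ++ (c ∷ X) ++ reverse (v ∷ a ∷ as)             ≡⟨ cong (λ t → (v ∷ a ∷ as) ++ (c ∷ X) ++ t) (reverse-∷∷ v a as) ⟩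
        (v ∷ a ∷ as) ++ (c ∷ X) ++ reverse as ++ a ∷ v ∷ []        ≡⟨ cong ((v ∷ a ∷ as) ++_) (++-assoc (c ∷ X) (reverse as) (a ∷ v ∷ [])) ⟨
        (v ∷ a ∷ as) ++ ((c ∷ X) ++ reverse as) ++ a ∷ v ∷ []      ≡⟨ ++-assoc (v ∷ a ∷ as) ((c ∷ X) ++ reverse as) (a ∷ v ∷ []) ⟨
        ((v ∷ a ∷ as) ++ (c ∷ X) ++ reverse as) ++ a ∷ v ∷ []      ∎

module _ {A : Set} (_≟_ : DecidableEquality A) (Adj : A → A → Set) (irreflexive : ∀ x → ¬ Adj x x) where

  Decomposition : List A → Set
  Decomposition X = ∃ λ as → ∃ λ c → ∃ λ c₁ → ∃ λ M →
    CyclicallyReduced (cycle c c₁ M) × X ≡ as ++ cycle c c₁ M ++ reverse as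

  -- peel matching first and last edges off a reduced cycle until its ends no longer backtrack
  cycle-decomposition : ∀ n (x b : A) Xm → length Xm ≤ n → Path Adj x (b ∷ Xm ++ x ∷ []) →
                        Reduced (cycle x b Xm) → Decomposition (cycle x b Xm)
  cycle-decomposition n x b Xm le path r with initLast Xm
  cycle-decomposition n x b .[] le path (x≢x , _) | [] = ⊥-elim (x≢x refl)
  cycle-decomposition n x b .(Y ∷ʳ b′) le path r | Y ∷ʳ′ b′ with b′ ≟ b
  ... | no b′≢b = [] , x , b , Y ∷ʳ b′ , cyclically-reduced-junction x b Y b′ r b′≢b , sym (++-identityʳ _)
  cycle-decomposition n x b .([] ∷ʳ b) le (_ , b~b , _) r | [] ∷ʳ′ b | yes refl = ⊥-elim (irreflexive b b~b)
  cycle-decomposition (suc n) x b .((d ∷ Y) ∷ʳ b) (s≤s le) path r | (d ∷ Y) ∷ʳ′ b | yes refl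
    with cycle-decomposition n b d Y (≤-trans (length-++-≤ˡ Y) le)
           (path-prefix Adj b _ (x ∷ []) (proj₂ path)) (reduced-prefix (cycle b d Y) (x ∷ []) (reduced-tail r))
  ... | as , c , c₁ , M , cr , eq = x ∷ as , c , c₁ , M , cr ,
    cong (x ∷_) (begin
      cycle b d Y ++ x ∷ []                                ≡⟨ cong (_++ x ∷ []) eq ⟩
      (as ++ C ++ reverse as) ++ x ∷ []                    ≡⟨ ++-assoc as (C ++ reverse as) (x ∷ []) ⟩
      as ++ (C ++ reverse as) ++ x ∷ []                    ≡⟨ cong (as ++_) (++-assoc C (reverse as) (x ∷ [])) ⟩
      as ++ C ++ reverse as ++ x ∷ []                      ≡⟨ cong (λ t → as ++ C ++ t) (unfold-reverse x as) ⟨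
      as ++ C ++ reverse (x ∷ as)                          ∎)
    where
      open ≡-Reasoning
      C : List A
      C = cycle c c₁ M

  conjugate-decomposition : ∀ v R → ClosedWalkFrom Adj v R → Reduced R → ¬ Reduced (R ++ drop 1 R) →
    ∃ λ as → ∃ λ c → ∃ λ c₁ → ∃ λ M → CyclicallyReduced (cycle c c₁ M) × R ≡ conjugate (v ∷ as) (cycle c c₁ M)
  conjugate-decomposition v (x ∷ []) _ _ ¬rr = ⊥-elim (¬rr tt)
  conjugate-decomposition v (.v ∷ b ∷ T) ((refl , path) , closed) r ¬rr with initLast T
  conjugate-decomposition v (.v ∷ b ∷ .[]) ((refl , (v~b , _)) , closed) r ¬rr | [] = ⊥-elim (irreflexive v (subst (Adj v) closed v~b))
  conjugate-decomposition v (.v ∷ b ∷ .(T ∷ʳ e)) ((refl , path) , closed) r ¬rr | T ∷ʳ′ e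
    with trans (sym (end-snoc b T e)) closed
  ... | refl with cycle-decomposition (length T) v b T ≤-refl path r
  ... | [] , c , c₁ , M , (_ , rr) , eq =
    ⊥-elim (¬rr (subst (λ X → Reduced (X ++ drop 1 X)) (sym (trans eq (++-identityʳ _))) rr))
  ... | a ∷ as , c , c₁ , M , cr , eq with ∷-injectiveˡ eq
  ... | refl = as , c , c₁ , M , cr , eq

-- A stack lists the reduced walk pushed so far from its end
-- backwards (top first), so that reduce W = reverse (pushAll [] W); pushing the vertex just below
-- the top cancels a backtrack.

module Stack {k : ℕ} where

  Stack : Set
  Stack = List (Fin k)

  pushAll : Stack → List (Fin k) → Stack
  pushAll = foldl push

  pushAll-++ : ∀ (s L M : Stack) → pushAll s (L ++ M) ≡ pushAll (pushAll s L) M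
  pushAll-++ = foldl-++ push

  pushAll-snoc : ∀ (s L : Stack) x → pushAll s (L ++ x ∷ []) ≡ push (pushAll s L) x
  pushAll-snoc s L x = foldl-++ push s L (x ∷ [])

  push-pop : ∀ (x y : Fin k) s w → w ≡ y → push (x ∷ y ∷ s) w ≡ y ∷ s
  push-pop x y s w w≡y with w ≟F y
  ... | yes _   = refl
  ... | no w≢y = ⊥-elim (w≢y w≡y)

  push-extend : ∀ (x y : Fin k) s w → w ≢ y → push (x ∷ y ∷ s) w ≡ w ∷ x ∷ y ∷ s
  push-extend x y s w w≢y with w ≟F y
  ... | yes w≡y = ⊥-elim (w≢y w≡y)
  ... | no _    = refl

  push-reduced : ∀ (s : Stack) w → Reduced s → Reduced (push s w)
  push-reduced []          w r = tt
  push-reduced (x ∷ [])     w r = tt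
  push-reduced (x ∷ y ∷ s) w r with w ≟F y
  ... | yes _   = reduced-tail r
  ... | no w≢y = w≢y , r

  pushAll-reduced : ∀ (s L : Stack) → Reduced s → Reduced (pushAll s L)
  pushAll-reduced s []      r = r
  pushAll-reduced s (x ∷ L) r = pushAll-reduced (push s x) L (push-reduced s x r)

  -- the top of the stack is the current endpoint of the walk
  Top : Fin k → Stack → Set
  Top h s = ∃ λ t → s ≡ h ∷ t

  push-top : ∀ (s : Stack) w → Top w (push s w)
  push-top []          w = [] , refl
  push-top (x ∷ [])     w = x ∷ [] , refl
  push-top (x ∷ y ∷ s) w with w ≟F y
  ... | yes w≡y = s , cong (_∷ s) (sym w≡y)
  ... | no _    = x ∷ y ∷ s , refl

  pushAll-top : ∀ (s L : Stack) h → Top h s → Top (end h L) (pushAll s L)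
  pushAll-top s []      h top = top
  pushAll-top s (x ∷ L) h top = pushAll-top (push s x) L x (push-top s x)

  Bottom : Fin k → Stack → Set
  Bottom h s = ∃ λ Z → s ≡ Z ++ h ∷ []

  push-bottom : ∀ (s : Stack) w h → Bottom h s → Bottom h (push s w)
  push-bottom []          w h ([] , ())
  push-bottom []          w h (_ ∷ _ , ())
  push-bottom (x ∷ [])     w h (Z , eq) = w ∷ Z , cong (w ∷_) eq
  push-bottom (x ∷ y ∷ s) w h ([] , ())
  push-bottom (x ∷ y ∷ s) w h (z ∷ Z , eq) with w ≟F y
  ... | yes _ = Z , ∷-injectiveʳ eq
  ... | no _  = w ∷ z ∷ Z , cong (w ∷_) eq

  pushAll-bottom : ∀ (s L : Stack) h → Bottom h s → Bottom h (pushAll s L)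
  pushAll-bottom s []      h bot = bot
  pushAll-bottom s (x ∷ L) h bot = pushAll-bottom (push s x) L h (push-bottom s x h bot)

  bottom-reverse : ∀ {h s} → Bottom h s → ∃ λ rest → reverse s ≡ h ∷ rest
  bottom-reverse {h} (Z , refl) = reverse Z , reverse-++ Z (h ∷ [])

  bottom-tail : ∀ {h a b r} → Bottom h (a ∷ b ∷ r) → Bottom h (b ∷ r)
  bottom-tail ([] , ())
  bottom-tail (z ∷ Z , eq) = Z , ∷-injectiveʳ eq

  backtrack : ∀ (x : Fin k) s w → Reduced (x ∷ s) → push (push (x ∷ s) w) x ≡ x ∷ s
  backtrack x []          w r = push-pop w x [] x refl
  backtrack x (y ∷ t) w r with w ≟F y
  backtrack x (y ∷ [])     w r        | yes _ = refl
  backtrack x (y ∷ c ∷ t) w (x≢c , _) | yes _ = push-extend y c t x x≢c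
  ... | no _ = push-pop w x (y ∷ t) x refl

  backtrack-top : ∀ s b a → Reduced s → Top b s → push (push s a) b ≡ s
  backtrack-top .(b ∷ t) b a r (t , refl) = backtrack b t a r

  pushAll-reduced-walk : ∀ (L Q : Stack) → Reduced (L ++ Q) → pushAll (reverse L) Q ≡ reverse (L ++ Q)
  pushAll-reduced-walk L []      r = cong reverse (sym (++-identityʳ L))
  pushAll-reduced-walk L (q ∷ Q) r = begin
    pushAll (push (reverse L) q) Q  ≡⟨ cong (λ s → pushAll s Q) (no-cancel (reverse L) refl) ⟩
    pushAll (reverse (L ∷ʳ q)) Q    ≡⟨ pushAll-reduced-walk (L ∷ʳ q) Q (subst Reduced (sym (++-assoc L (q ∷ []) Q)) r) ⟩
    reverse ((L ∷ʳ q) ++ Q)         ≡⟨ cong reverse (++-assoc L (q ∷ []) Q) ⟩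
    reverse (L ++ q ∷ Q)            ∎
    where
      open ≡-Reasoning
      no-cancel : ∀ s → reverse L ≡ s → push s q ≡ reverse (L ∷ʳ q)
      no-cancel []          eq = trans (cong (q ∷_) (sym eq)) (sym (reverse-++ L (q ∷ [])))
      no-cancel (x ∷ [])     eq = trans (cong (q ∷_) (sym eq)) (sym (reverse-++ L (q ∷ [])))
      no-cancel (x ∷ y ∷ t) eq = begin
        push (x ∷ y ∷ t) q    ≡⟨ push-extend x y t q (λ q≡y → reduced-middle (reverse t) y x q Q r′ (sym q≡y)) ⟩
        q ∷ x ∷ y ∷ t         ≡⟨ cong (q ∷_) eq ⟨
        q ∷ reverse L         ≡⟨ reverse-++ L (q ∷ []) ⟨
        reverse (L ∷ʳ q)      ∎
        where
          L≡ : L ≡ reverse t ++ y ∷ x ∷ []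
          L≡ = trans (sym (reverse-involutive L)) (trans (cong reverse eq) (reverse-∷∷ x y t))
          r′ : Reduced (reverse t ++ y ∷ x ∷ q ∷ Q)
          r′ = subst Reduced (trans (cong (_++ q ∷ Q) L≡) (++-assoc (reverse t) (y ∷ x ∷ []) (q ∷ Q))) r

  reduce-reduced : ∀ (X : Stack) → Reduced X → reduce X ≡ X
  reduce-reduced X r = trans (cong reverse (pushAll-reduced-walk [] X r)) (reverse-involutive X)

  pushAll-retrace : ∀ (L s : Stack) h → Reduced s → Top h s →
                    pushAll (pushAll s L) (drop 1 (reverse (h ∷ L))) ≡ s
  pushAll-retrace []      s       h r top      = refl
  pushAll-retrace (x ∷ L) .(h ∷ t) h r (t , refl) with reverse-head x L
  ... | rest , eq = begin
    pushAll (pushAll s′ L) (drop 1 (reverse (h ∷ x ∷ L)))   ≡⟨ cong (pushAll (pushAll s′ L)) (drop1-reverse-∷ h (x ∷ L) _ rest eq) ⟩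
    pushAll (pushAll s′ L) (rest ++ h ∷ [])                 ≡⟨ pushAll-snoc (pushAll s′ L) rest h ⟩
    push (pushAll (pushAll s′ L) rest) h                    ≡⟨ cong (λ s → push (pushAll (pushAll s′ L) s) h) (cong (drop 1) eq) ⟨
    push (pushAll (pushAll s′ L) (drop 1 (reverse (x ∷ L)))) h
                                                            ≡⟨ cong (λ s → push s h) (pushAll-retrace L s′ x (push-reduced (h ∷ t) x r) (push-top (h ∷ t) x)) ⟩
    push s′ h                                               ≡⟨ backtrack h t x r ⟩
    h ∷ t                                                   ∎
    where
      open ≡-Reasoning
      s′ : Stack
      s′ = push (h ∷ t) x

  pushAll-closed-retrace : ∀ v (L₁ L₂ : Stack) → end v L₁ ≡ end v L₂ →
    pushAll (reverse (reduce ((v ∷ L₁) ++ drop 1 (reverse (v ∷ L₂))))) L₂ ≡ pushAll [] (v ∷ L₁)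
  pushAll-closed-retrace v L₁ L₂ ends with reverse-head v L₂
  ... | M , eq = begin
    pushAll (reverse (reduce ((v ∷ L₁) ++ back))) L₂      ≡⟨ cong (λ t → pushAll t L₂) (reverse-involutive (pushAll [] ((v ∷ L₁) ++ back))) ⟩
    pushAll (pushAll [] ((v ∷ L₁) ++ back)) L₂           ≡⟨ cong (λ t → pushAll t L₂) (pushAll-++ [] (v ∷ L₁) back) ⟩
    pushAll (pushAll s back) L₂                          ≡⟨ cong (λ t → pushAll (pushAll s (drop 1 t)) L₂) eq ⟩
    pushAll (pushAll s M) L₂                             ≡⟨ cong (λ t → pushAll (pushAll s M) (drop 1 t)) forth ⟨
    pushAll (pushAll s M) (drop 1 (reverse (end v L₂ ∷ M))) ≡⟨ pushAll-retrace M s (end v L₂) (pushAll-reduced [] (v ∷ L₁) tt) top ⟩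
    s                                                    ∎
    where
      open ≡-Reasoning
      back : Stack
      back = drop 1 (reverse (v ∷ L₂))
      s : Stack
      s = pushAll [] (v ∷ L₁)
      forth : reverse (end v L₂ ∷ M) ≡ v ∷ L₂
      forth = trans (cong reverse (sym eq)) (reverse-involutive (v ∷ L₂))
      top : Top (end v L₂) s
      top = subst (λ h → Top h s) ends (pushAll-top (v ∷ []) L₁ v ([] , refl))

  pushAll-pop : ∀ (x : Fin k) as t → pushAll (x ∷ as ++ t) as ≡ end x as ∷ t
  pushAll-pop x []       t = refl
  pushAll-pop x (a ∷ as) t = trans (cong (λ s → pushAll s as) (push-pop x a (as ++ t) a refl)) (pushAll-pop a as t)

  push-after-reduced : ∀ (T : Stack) h → Reduced T → Top h T → ∀ σ x → Bottom h σ →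
                       push (pushAll T (drop 1 (reverse σ))) x ≡ pushAll T (drop 1 (reverse (push σ x)))
  push-after-reduced T h rT topT []          x ([] , ())
  push-after-reduced T h rT topT []          x (_ ∷ _ , ())
  push-after-reduced T h rT topT (a ∷ [])     x bot = refl
  push-after-reduced T h rT topT (a ∷ b ∷ r) x bot with x ≟F b | bottom-reverse (bottom-tail bot)
  ... | yes x≡b | rest , eq = begin
    push (pushAll T (drop 1 (reverse (a ∷ b ∷ r)))) x   ≡⟨ cong (λ s → push (pushAll T s) x) (drop1-reverse-∷ a (b ∷ r) h rest eq) ⟩
    push (pushAll T (rest ++ a ∷ [])) x                 ≡⟨ cong (λ s → push s x) (pushAll-snoc T rest a) ⟩
    push (push β a) x                                   ≡⟨ cong (push (push β a)) x≡b ⟩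
    push (push β a) b                                   ≡⟨ backtrack-top β b a (pushAll-reduced T rest rT) top-β ⟩
    β                                                   ≡⟨ cong (λ s → pushAll T (drop 1 s)) eq ⟨
    pushAll T (drop 1 (reverse (b ∷ r)))                ∎
    where
      open ≡-Reasoning
      β : Stack
      β = pushAll T rest
      top-β : Top b β
      top-β = subst (λ t → Top t β) (trans (cong (end h) (sym eq)) (end-reverse h b r)) (pushAll-top T rest h topT)
  ... | no _ | _ with bottom-reverse bot
  ... | rest , eq = begin
    push (pushAll T (drop 1 (reverse (a ∷ b ∷ r)))) x   ≡⟨ cong (λ s → push (pushAll T (drop 1 s)) x) eq ⟩
    push (pushAll T rest) x                             ≡⟨ pushAll-snoc T rest x ⟨
    pushAll T (rest ++ x ∷ [])                          ≡⟨ cong (pushAll T) (drop1-reverse-∷ x (a ∷ b ∷ r) h rest eq) ⟨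
    pushAll T (drop 1 (reverse (x ∷ a ∷ b ∷ r)))        ∎
    where open ≡-Reasoning

  pushAll-reduce : ∀ (T : Stack) h L → Reduced T → Top h T →
                   pushAll T L ≡ pushAll T (drop 1 (reduce (h ∷ L)))
  pushAll-reduce T h L rT topT = by-snoc L (reverseView L)
    where
      open ≡-Reasoning
      by-snoc : ∀ L → Reverse L → pushAll T L ≡ pushAll T (drop 1 (reduce (h ∷ L)))
      by-snoc .[]         []              = refl
      by-snoc .(L ∷ʳ x) (L ∶ rest ∶ʳ x) = begin
        pushAll T (L ∷ʳ x)                              ≡⟨ pushAll-snoc T L x ⟩
        push (pushAll T L) x                            ≡⟨ cong (λ s → push s x) (by-snoc L rest) ⟩
        push (pushAll T (drop 1 (reverse σ))) x         ≡⟨ push-after-reduced T h rT topT σ x (pushAll-bottom (h ∷ []) L h ([] , refl)) ⟩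
        pushAll T (drop 1 (reverse (push σ x)))         ≡⟨ cong (λ s → pushAll T (drop 1 (reverse s))) (pushAll-snoc (h ∷ []) L x) ⟨
        pushAll T (drop 1 (reduce (h ∷ L ∷ʳ x)))        ∎
        where
          σ : Stack
          σ = pushAll (h ∷ []) L

module Powers {k : ℕ} where
  open Stack {k}

  conjugate-product : ∀ v as X c Y → Reduced (conjugate (v ∷ as) (X ∷ʳ c)) →
                      Reduced (conjugate (v ∷ as) ((X ∷ʳ c) ++ Y)) →
                      conjugate (v ∷ as) (X ∷ʳ c) · conjugate (v ∷ as) (c ∷ Y) ≡ conjugate (v ∷ as) ((X ∷ʳ c) ++ Y)
  conjugate-product v as X c Y rX rXY = begin
    reverse (pushAll [] (conjugate U X̂ ++ as ++ c ∷ Y ++ rU))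
      ≡⟨ cong reverse (pushAll-++ [] (conjugate U X̂) (as ++ c ∷ Y ++ rU)) ⟩
    reverse (pushAll (pushAll [] (conjugate U X̂)) (as ++ c ∷ Y ++ rU))
      ≡⟨ cong (λ s → reverse (pushAll s (as ++ c ∷ Y ++ rU))) (pushAll-reduced-walk [] (conjugate U X̂) rX) ⟩
    reverse (pushAll (reverse (conjugate U X̂)) (as ++ c ∷ Y ++ rU))
      ≡⟨ cong₂ (λ s t → reverse (pushAll s t)) stack-eq (sym (++-assoc as (c ∷ []) (Y ++ rU))) ⟩
    reverse (pushAll (v ∷ (as ∷ʳ c) ++ S) ((as ∷ʳ c) ++ Y ++ rU))
      ≡⟨ cong reverse (pushAll-++ (v ∷ (as ∷ʳ c) ++ S) (as ∷ʳ c) (Y ++ rU)) ⟩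
    reverse (pushAll (pushAll (v ∷ (as ∷ʳ c) ++ S) (as ∷ʳ c)) (Y ++ rU))
      ≡⟨ cong (λ s → reverse (pushAll s (Y ++ rU))) (pushAll-pop v (as ∷ʳ c) S) ⟩
    reverse (pushAll (end v (as ∷ʳ c) ∷ S) (Y ++ rU))
      ≡⟨ cong (λ x → reverse (pushAll (x ∷ S) (Y ++ rU))) (end-snoc v as c) ⟩
    reverse (pushAll (c ∷ S) (Y ++ rU))
      ≡⟨ cong (λ s → reverse (pushAll s (Y ++ rU))) popped-eq ⟩
    reverse (pushAll (reverse (U ++ X̂)) (Y ++ rU))
      ≡⟨ cong reverse (pushAll-reduced-walk (U ++ X̂) (Y ++ rU) (subst Reduced (sym assoc) rXY)) ⟩
    reverse (reverse ((U ++ X̂) ++ Y ++ rU))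
      ≡⟨ reverse-involutive _ ⟩
    (U ++ X̂) ++ Y ++ rU
      ≡⟨ assoc ⟩
    conjugate U (X̂ ++ Y)
      ∎
    where
      open ≡-Reasoning
      U : Stack
      U = v ∷ as
      rU : Stack
      rU = reverse U
      X̂ : Stack
      X̂ = X ∷ʳ c
      S : Stack
      S = reverse X ++ rU
      stack-eq : reverse (conjugate U X̂) ≡ v ∷ (as ∷ʳ c) ++ S
      stack-eq = trans (reverse-conjugate U X̂)
        (cong (v ∷_) (trans (cong (λ t → as ++ t ++ rU) (reverse-++ X (c ∷ []))) (sym (++-assoc as (c ∷ []) S))))
      popped-eq : c ∷ S ≡ reverse (U ++ X̂)
      popped-eq = sym (trans (reverse-++ U X̂) (cong (_++ rU) (reverse-++ X (c ∷ []))))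
      assoc : (U ++ X̂) ++ Y ++ rU ≡ conjugate U (X̂ ++ Y)
      assoc = trans (++-assoc U X̂ (Y ++ rU)) (cong (U ++_) (sym (++-assoc X̂ Y rU)))

  module Cycle (c c₁ : Fin k) (M : Stack) where

    C : Stack
    C = cycle c c₁ M

    -- the rest of the closed walk going m + 1 times around C, after its first edge c c₁
    laps : ℕ → Stack
    laps zero    = M ++ c ∷ []
    laps (suc m) = M ++ c ∷ c₁ ∷ laps m

    -- C^(m+1)
    around : ℕ → Stack
    around m = c ∷ c₁ ∷ laps m

    around-step : ∀ m → C ++ drop 1 (around m) ≡ around (suc m)
    around-step m = cong (λ t → c ∷ c₁ ∷ t) (++-assoc M (c ∷ []) (c₁ ∷ laps m))

    around-ends-with-C : ∀ m → ∃ λ Z → around m ≡ Z ++ C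
    around-ends-with-C zero    = [] , refl
    around-ends-with-C (suc m) with around-ends-with-C m
    ... | Z , eq = (c ∷ c₁ ∷ M) ++ Z , trans (cong ((c ∷ c₁ ∷ M) ++_) eq) (sym (++-assoc (c ∷ c₁ ∷ M) Z C))

    around-reduced : CyclicallyReduced C → ∀ m → Reduced (around m)
    around-reduced (r , _)  zero    = r
    around-reduced cr (suc m) = reduced-glue (c ∷ c₁ ∷ M) c c₁ (laps m) junction (around-reduced cr m)
      where
        junction : Reduced ((c ∷ c₁ ∷ M) ++ c ∷ c₁ ∷ [])
        junction = reduced-prefix _ (laps zero)
          (subst Reduced (trans (around-step zero) (sym (++-assoc (c ∷ c₁ ∷ M) (c ∷ c₁ ∷ []) (laps zero)))) (proj₂ cr))

    module _ (v : Fin k) (as : Stack) (cr : CyclicallyReduced C) (rR : Reduced (conjugate (v ∷ as) C)) where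

      conjugate-around-reduced : ∀ m → Reduced (conjugate (v ∷ as) (around m))
      conjugate-around-reduced m with around-ends-with-C m
      ... | Z , eq = subst (λ X → Reduced (conjugate (v ∷ as) X)) (sym eq)
        (reduced-insert (v ∷ as) Z c c₁ (laps zero) (reverse (v ∷ as)) (laps m) (sym eq) rR
          (subst Reduced eq (around-reduced cr m)))

      conjugate-powℕ : ∀ m → powℕ v (conjugate (v ∷ as) C) (suc m) ≡ conjugate (v ∷ as) (around m)
      conjugate-powℕ zero    = trans (cong reduce (++-identityʳ (conjugate (v ∷ as) C))) (reduce-reduced (conjugate (v ∷ as) C) rR)
      conjugate-powℕ (suc m) = begin
        conjugate (v ∷ as) C · powℕ v (conjugate (v ∷ as) C) (suc m)
          ≡⟨ cong (conjugate (v ∷ as) C ·_) (conjugate-powℕ m) ⟩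
        conjugate (v ∷ as) ((c ∷ c₁ ∷ M) ∷ʳ c) · conjugate (v ∷ as) (c ∷ c₁ ∷ laps m)
          ≡⟨ conjugate-product v as (c ∷ c₁ ∷ M) c (c₁ ∷ laps m) rR
               (subst (λ X → Reduced (conjugate (v ∷ as) X)) (sym (around-step m)) (conjugate-around-reduced (suc m))) ⟩
        conjugate (v ∷ as) (C ++ drop 1 (around m))
          ≡⟨ cong (conjugate (v ∷ as)) (around-step m) ⟩
        conjugate (v ∷ as) (around (suc m))
          ∎
        where open ≡-Reasoning

      powℕ-flanked : ∀ m → Flanked v (firstStep as c) (powℕ v (conjugate (v ∷ as) C) (suc m))
      powℕ-flanked m with around-ends-with-C m
      ... | Z , eq = subst (Flanked v (firstStep as c)) (sym (conjugate-powℕ m))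
        (conjugate-flanked v as c (c₁ ∷ laps m) (Z ++ c ∷ c₁ ∷ M)
          (conjugate-around-reduced m) (trans eq (sym (++-assoc Z (c ∷ c₁ ∷ M) (c ∷ [])))))

  conjugate-pow-flanked : ∀ v as c c₁ M → CyclicallyReduced (cycle c c₁ M) → Reduced (conjugate (v ∷ as) (cycle c c₁ M)) →
                          ∀ i → Flanked v (firstStep as c) (pow v (conjugate (v ∷ as) (cycle c c₁ M)) i)
  conjugate-pow-flanked v as c c₁ M cr rR (+ zero)  = tt , inj₁ refl
  conjugate-pow-flanked v as c c₁ M cr rR (+ suc m) = Cycle.powℕ-flanked c c₁ M v as cr rR m
  conjugate-pow-flanked v as c c₁ M cr rR -[1+ m ] with reverse-cycle c c₁ M
  ... | c₁′ , M′ , eq =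
    subst (Flanked v (firstStep as c)) (cong (λ R → powℕ v R (suc m)) (sym reverse-R))
      (Cycle.powℕ-flanked c c₁′ M′ v as cr′ (subst Reduced reverse-R (reduced-reverse _ rR)) m)
    where
      reverse-R : reverse (conjugate (v ∷ as) (cycle c c₁ M)) ≡ conjugate (v ∷ as) (cycle c c₁′ M′)
      reverse-R = trans (reverse-conjugate (v ∷ as) _) (cong (λ X → conjugate (v ∷ as) X) eq)
      cr′ : CyclicallyReduced (cycle c c₁′ M′)
      cr′ = subst CyclicallyReduced eq (cyclically-reduced-reverse c (c₁ ∷ M) cr)

¬¬-finite-∀ : ∀ m (P : Fin m → Set) → (∀ i → ¬ ¬ P i) → ¬ ¬ (∀ i → P i)
¬¬-finite-∀ zero    P ¬¬P k = k (λ ())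
¬¬-finite-∀ (suc m) P ¬¬P k =
  ¬¬P zero (λ p₀ → ¬¬-finite-∀ m (λ i → P (suc i)) (λ i → ¬¬P (suc i))
    (λ ps → k (λ { zero → p₀ ; (suc i) → ps i })))

decidable-subset : ∀ {m} (P : Fin m → Set) → (∀ i → Dec (P i)) →
                   ∃ λ (S : Subset m) → ∀ i → (i ∈ S → P i) × (P i → i ∈ S)
decidable-subset {m} P P? = S , λ i → member→P i , P→member i
  where
    S : Subset m
    S = tabulate (λ i → does (P? i))
    member→P : ∀ i → i ∈ S → P i
    member→P i i∈S with P? i | trans (sym (lookup∘tabulate (λ i → does (P? i)) i)) ([]=⇒lookup i∈S)
    ... | yes p | _ = p
    ... | no _  | ()
    P→member : ∀ i → P i → i ∈ S
    P→member i p with P? i | lookup⇒[]= i S (lookup∘tabulate (λ i → does (P? i)) i)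
    ... | yes _  | i∈S = i∈S
    ... | no ¬p  | _   = ⊥-elim (¬p p)

tensor-sym : ∀ (G H : Graph) x y → TensorE G H x y → TensorE G H y x
tensor-sym G H (g , h) (g′ , h′) (g~g′ , h~h′) = trans (adj-sym G g′ g) g~g′ , trans (adj-sym H h′ h) h~h′

edge-irreflexive : ∀ (X : Graph) x → ¬ E X x x
edge-irreflexive X x x~x with trans (sym x~x) (irrefl X x)
... | ()

module _ (G : Graph) (connected : Connected G) where

  spread : (P : V G → Set) → (∀ g g′ → E G g g′ → P g → P g′) → ∀ g₁ → P g₁ → ∀ g → P g
  spread P step g₁ p g with connected g₁ g
  ... | W , walk , ends = subst P ends (walk-transport (E G) P step g₁ W walk p)

  second-neighbourhood-closed : ¬ Bipartite G → (S : V G → Set) → (∀ g → Dec (S g)) → ∀ g₁ → S g₁ →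
                                (∀ g g′ g″ → S g → E G g g′ → E G g′ g″ → S g″) → ∀ g → S g
  second-neighbourhood-closed non-bipartite S S? g₁ s₁ closed =
    decidable-stable (all? S?) λ ¬all → ¬¬-excluded-middle {A = ∃ λ g → S g × N g} λ
      { (yes (g , s , n)) → ¬all (λ g′ → proj₁ (spread (λ u → S u × N u) both-step g (s , n) g′))
      ; (no ¬both)        → non-bipartite ((λ g → does (S? g)) , proper ¬both) }
    where
      N : V G → Set
      N g′ = ∃ λ g → S g × E G g g′

      out : ∀ g g′ → E G g g′ → S g → N g′
      out g g′ e s = g , s , e

      back : ∀ g g′ → E G g g′ → N g → S g′
      back g g′ e (g₀ , s , e₀) = closed g₀ g g′ s e₀ e

      both-step : ∀ g g′ → E G g g′ → S g × N g → S g′ × N g′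
      both-step g g′ e (s , n) = back g g′ e n , out g g′ e s

      covered : ∀ g → S g ⊎ N g
      covered = spread (λ u → S u ⊎ N u) step g₁ (inj₁ s₁)
        where
          step : ∀ g g′ → E G g g′ → S g ⊎ N g → S g′ ⊎ N g′
          step g g′ e (inj₁ s) = inj₂ (out g g′ e s)
          step g g′ e (inj₂ n) = inj₁ (back g g′ e n)

      proper : ¬ (∃ λ g → S g × N g) → ∀ u u′ → E G u u′ → does (S? u) ≢ does (S? u′)
      proper ¬both u u′ e with S? u | S? u′ | covered u
      ... | yes su | yes su′ | _      = ⊥-elim (¬both (u′ , su′ , out u u′ e su))
      ... | yes _  | no _    | _      = λ ()
      ... | no _   | yes _   | _      = λ ()
      ... | no ¬su | no _    | inj₁ su = ⊥-elim (¬su su)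
      ... | no _   | no ¬su′ | inj₂ n  = ⊥-elim (¬su′ (back u u′ e n))

module Lifting (G H K : Graph) (μ : V G × V H → V K) (g₀ : V G) (h₀ : V H) (R : List (V K)) (w : V K)
               (walks-to-powers : ∀ C → ClosedWalkFrom (TensorE G H) (g₀ , h₀) C →
                                  ∃ λ (i : ℤ) → reduce (map μ C) ≡ pow (μ (g₀ , h₀)) R i)
               (powers-flanked : ∀ i → Flanked (μ (g₀ , h₀)) w (pow (μ (g₀ , h₀)) R i)) where

  open Stack {n K}

  Vt : Set
  Vt = V G × V H

  base : Vt
  base = g₀ , h₀

  v : V K
  v = μ base

  TE : Vt → Vt → Set
  TE = TensorE G H

  LiftsTo : Vt → Stack → Set
  LiftsTo y s = ∃ λ W → WalkFrom TE base W × end base W ≡ y × pushAll [] (map μ W) ≡ s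

  lift-base : LiftsTo base (v ∷ [])
  lift-base = base ∷ [] , (refl , tt) , refl , refl

  lift-extend : ∀ {y s} z → LiftsTo y s → TE y z → LiftsTo z (push s (μ z))
  lift-extend z (.base ∷ W , (refl , path) , ends , stack) y~z =
    base ∷ (W ++ z ∷ []) ,
    (refl , path-++ TE base W (z ∷ []) path (subst (λ t → TE t z) (sym ends) y~z , tt)) ,
    end-snoc base W z ,
    trans (cong (pushAll []) (map-++ μ (base ∷ W) (z ∷ [])))
      (trans (pushAll-snoc [] (map μ (base ∷ W)) (μ z)) (cong (λ t → push t (μ z)) stack))

  lift-reduced : ∀ {y s} → LiftsTo y s → Reduced s
  lift-reduced (W , _ , _ , stack) = subst Reduced stack (pushAll-reduced [] (map μ W) tt)

  lift-top : ∀ {y s} → LiftsTo y s → Top (μ y) s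
  lift-top (.base ∷ W , (refl , _) , ends , refl) =
    subst (λ h → Top h (pushAll (v ∷ []) (map μ W))) (trans (end-map μ base W) (cong μ ends)) (pushAll-top (v ∷ []) (map μ W) v ([] , refl))

  lift-bottom : ∀ {y s} → LiftsTo y s → Bottom v s
  lift-bottom (.base ∷ W , (refl , _) , _ , refl) = pushAll-bottom (v ∷ []) (map μ W) v ([] , refl)

  Admissible : Stack → Set
  Admissible s = ∀ Y → reverse s ≢ v ∷ w ∷ Y

  closed-walk : ∀ {y} W₁ W₂ → Path TE base W₁ → end base W₁ ≡ y → Path TE base W₂ → end base W₂ ≡ y →
                ClosedWalkFrom TE base (base ∷ W₁ ++ drop 1 (reverse (base ∷ W₂)))
  closed-walk W₁ W₂ p₁ e₁ p₂ e₂ = (refl , path-++ TE base W₁ back p₁ back-path) , ends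
    where
      back : List Vt
      back = drop 1 (reverse (base ∷ W₂))
      back-path : Path TE (end base W₁) back
      back-path = subst (λ t → Path TE t back) (trans e₂ (sym e₁)) (path-reverse TE (tensor-sym G H) base W₂ p₂)
      ends : end base (W₁ ++ back) ≡ base
      ends = trans (end-++ base W₁ back) (trans (cong (λ t → end t back) (trans e₁ (sym e₂))) (end-retrace base W₂))

  admissible-unique : ∀ {y s₁ s₂} → LiftsTo y s₁ → LiftsTo y s₂ → Admissible s₁ → Admissible s₂ → s₁ ≡ s₂
  admissible-unique {y} {s₁} {s₂} (.base ∷ W₁ , (refl , p₁) , e₁ , refl) l₂@(.base ∷ W₂ , (refl , p₂) , e₂ , refl) adm₁ adm₂
    with walks-to-powers _ (closed-walk W₁ W₂ p₁ e₁ p₂ e₂)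
  ... | i , image = compare (pow v R i) (powers-flanked i) retrace
    where
      L₂ : Stack
      L₂ = map μ W₂

      retrace : pushAll (reverse (pow v R i)) L₂ ≡ s₁
      retrace = trans (cong (λ E → pushAll (reverse E) L₂) (trans (sym image) (cong reduce (map-retrace μ base W₁ W₂))))
        (pushAll-closed-retrace v (map μ W₁) L₂
          (trans (end-map μ base W₁) (trans (cong μ (trans e₁ (sym e₂))) (sym (end-map μ base W₂)))))

      compare : ∀ E → Flanked v w E → pushAll (reverse E) L₂ ≡ s₁ → s₁ ≡ s₂
      compare .(v ∷ []) (_ , inj₁ refl) eq = sym eq
      compare E (rE , inj₂ ((Z₁ , starts) , (Z₂ , ends))) eq with bottom-reverse (lift-bottom l₂)
      ... | Q , rev₂ = ⊥-elim (adm₁ (Z₁ ++ Q) (begin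
        reverse s₁                                   ≡⟨ cong reverse (sym eq) ⟩
        reverse (pushAll (reverse E) L₂)             ≡⟨ cong reverse (pushAll-reduce (reverse E) v L₂ (reduced-reverse E rE) top) ⟩
        reverse (pushAll (reverse E) (drop 1 (reverse s₂)))
                                                     ≡⟨ cong (λ t → reverse (pushAll (reverse E) (drop 1 t))) rev₂ ⟩
        reverse (pushAll (reverse E) Q)              ≡⟨ cong reverse (pushAll-reduced-walk E Q reduced-EQ) ⟩
        reverse (reverse (E ++ Q))                   ≡⟨ reverse-involutive (E ++ Q) ⟩
        E ++ Q                                       ≡⟨ cong (_++ Q) starts ⟩
        v ∷ w ∷ Z₁ ++ Q                              ∎))
        where
          open ≡-Reasoning
          top : Top v (reverse E)
          top = w ∷ reverse Z₂ , trans (cong reverse ends) (reverse-++ Z₂ (w ∷ v ∷ []))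
          -- the reduced image of W₂, v ∷ Q, does not start with v w, so E ++ Q is reduced
          w-v : ∀ Q′ → reverse s₂ ≡ v ∷ Q′ → Reduced (w ∷ v ∷ Q′)
          w-v []       _   = tt
          w-v (q ∷ Q′) rev = (λ w≡q → adm₂ Q′ (trans rev (cong (λ t → v ∷ t ∷ Q′) (sym w≡q)))) ,
                             subst Reduced rev (reduced-reverse s₂ (lift-reduced l₂))
          reduced-EQ : Reduced (E ++ Q)
          reduced-EQ = subst Reduced (sym (trans (cong (_++ Q) ends) (++-assoc Z₂ (w ∷ v ∷ []) Q)))
                         (reduced-glue Z₂ w v Q (subst Reduced ends rE) (w-v Q rev₂))

  Long : ℕ → Set
  Long j = ∃ λ y → ∃ λ s → LiftsTo y s × Admissible s × length s ≡ suc j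

  -- the one vertex whose push onto s backtracks (or, for s = v, leaves v towards w)
  forbiddenNext : Stack → V K
  forbiddenNext (_ ∷ b ∷ _) = b
  forbiddenNext _           = w

  push-other : ∀ s u → u ≢ forbiddenNext s → push s u ≡ u ∷ s
  push-other []          u _   = refl
  push-other (x ∷ [])     u _   = refl
  push-other (x ∷ y ∷ t) u u≢y = push-extend x y t u u≢y

  admissible-extend : ∀ s u → Admissible s → u ≢ forbiddenNext s → Admissible (u ∷ s)
  admissible-extend s u adm u≢b Y eq with ∷ʳ-two-prefix (reverse s) u v w Y (trans (sym (unfold-reverse u s)) eq)
  ... | inj₂ (Y′ , eq′)   = adm Y′ eq′
  ... | inj₁ (eq′ , u≡w) = u≢b (trans u≡w (sym (cong forbiddenNext s≡v)))
    where
      s≡v : s ≡ v ∷ []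
      s≡v = trans (sym (reverse-involutive s)) (cong reverse eq′)

  module _ (no-extremal : NoHExtremal G H K μ) (non-constant : ∀ h → ¬ (∀ g g′ → μ (g , h) ≡ μ (g′ , h)))
           (connected : Connected G) (non-bipartite : ¬ Bipartite G) where

    -- an admissible stack s of maximal length, carried by (g₁ , h₁), is contradictory: the vertices
    -- of the layer h₁ carrying s form an H-extremal set, unless they are all of V(G) × {h₁}
    module MaximalLift (g₁ : V G) (h₁ : V H) (s : Stack) (lift : LiftsTo (g₁ , h₁) s) (adm : Admissible s)
                       (maximal : ¬ Long (length s)) (carries? : ∀ g → Dec (LiftsTo (g , h₁) s)) where

      S-spec : ∃ λ (S : Subset (n G)) → ∀ g → (g ∈ S → LiftsTo (g , h₁) s) × (LiftsTo (g , h₁) s → g ∈ S)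
      S-spec = decidable-subset (λ g → LiftsTo (g , h₁) s) carries?

      S : Subset (n G)
      S = proj₁ S-spec

      carries : ∀ {g} → g ∈ S → LiftsTo (g , h₁) s
      carries {g} = proj₁ (proj₂ S-spec g)

      S∋ : ∀ {g} → LiftsTo (g , h₁) s → g ∈ S
      S∋ {g} = proj₂ (proj₂ S-spec g)

      h₀′ : V H
      h₀′ = proj₁ (noIso H h₁)

      h₁~h₀′ : E H h₁ h₀′
      h₁~h₀′ = proj₂ (noIso H h₁)

      h₀′~h₁ : E H h₀′ h₁
      h₀′~h₁ = trans (adj-sym H h₀′ h₁) h₁~h₀′

      a : V K
      a = μ (g₁ , h₁)

      b : V K
      b = forbiddenNext s

      S′ : Vt → Set
      S′ = Lift G H S h₁

      N : Vt → Set
      N = Nbhd G H h₀′ h₁ S′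

      N² : Vt → Set
      N² = Nbhd2 G H h₀′ h₁ S′

      lift-S′ : ∀ x → S′ x → LiftsTo x s
      lift-S′ (g , .h₁) (g∈S , refl) = carries g∈S

      image-S : ∀ x → S′ x → μ x ≡ a
      image-S x x∈S′ with lift-top (lift-S′ x x∈S′) | lift-top lift
      ... | t , eq | t′ , eq′ = ∷-injectiveˡ (trans (sym eq) eq′)

      -- by maximality, every neighbour of S′ is mapped to the forbidden vertex
      image-N : ∀ y → N y → μ y ≡ b
      image-N y (x , x∈S′ , (_ , _ , x~y)) with μ y ≟F b
      ... | yes μy≡b = μy≡b
      ... | no μy≢b  = ⊥-elim (maximal (y , μ y ∷ s ,
              subst (LiftsTo y) (push-other s (μ y) μy≢b) (lift-extend y (lift-S′ x x∈S′) x~y) ,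
              admissible-extend s (μ y) adm μy≢b , refl))

      return : ∀ x y gz → S′ x → TE x y → N y → TE y (gz , h₁) → μ (gz , h₁) ≡ a → gz ∈ S
      return x y gz x∈S′ x~y y∈N y~z μz≡a =
        S∋ (subst (LiftsTo (gz , h₁)) (trans (cong (push (push s b)) μz≡a) (backtrack-top s a b (lift-reduced lift) (lift-top lift)))
              (lift-extend (gz , h₁) (subst (λ t → LiftsTo y (push s t)) (image-N y y∈N) (lift-extend y (lift-S′ x x∈S′) x~y)) y~z))

      image-N² : ∀ z → N² z → μ z ≢ a
      image-N² (gz , hz) (((gy , hy) , ((gx , hx) , (_ , refl) , (_ , inj₂ refl , (_ , h₁~h₁))) , _) , _) _ =
        edge-irreflexive H h₁ h₁~h₁
      image-N² (gz , hz) (((gy , hy) , (x , _ , (_ , inj₁ refl , _)) , (_ , inj₁ refl , (_ , h₀′~h₀′))) , _) _ =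
        edge-irreflexive H h₀′ h₀′~h₀′
      image-N² (gz , hz) (((gy , hy) , y∈N@(x , x∈S′ , (_ , inj₁ refl , x~y)) , (_ , inj₂ refl , y~z)) , z∉S′) μz≡a =
        z∉S′ (return x (gy , hy) gz x∈S′ x~y y∈N y~z μz≡a , refl)

      S∋g₁ : g₁ ∈ S
      S∋g₁ = S∋ lift

      N-inhabited : N (proj₁ (noIso G g₁) , h₀′)
      N-inhabited = (g₁ , h₁) , (S∋g₁ , refl) , (inj₂ refl , inj₁ refl , (proj₂ (noIso G g₁) , h₁~h₀′))

      extremal : ∃ N² → IsHExtremal G H K μ S h₀′ h₁
      extremal z∈N² = h₀′~h₁ , a , b , (((g₁ , h₁) , S∋g₁ , refl) , image-S) , ((_ , N-inhabited) , image-N) ,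
                      z∈N² , image-N²

      closed : ¬ ∃ N² → ∀ g g′ g″ → g ∈ S → E G g g′ → E G g′ g″ → g″ ∈ S
      closed no-N² g g′ g″ g∈S g~g′ g′~g″ with g″ ∈? S
      ... | yes g″∈S = g″∈S
      ... | no g″∉S  = ⊥-elim (no-N² ((g″ , h₁) ,
              ((g′ , h₀′) , ((g , h₁) , (g∈S , refl) , (inj₂ refl , inj₁ refl , (g~g′ , h₁~h₀′))) ,
                            (inj₁ refl , inj₂ refl , (g′~g″ , h₀′~h₁))) ,
              λ z∈S′ → g″∉S (proj₁ z∈S′)))

      constant : ¬ ∃ N² → ∀ g g′ → μ (g , h₁) ≡ μ (g′ , h₁)
      constant no-N² g g′ = trans (image-S (g , h₁) (everywhere g , refl)) (sym (image-S (g′ , h₁) (everywhere g′ , refl)))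
        where
          everywhere : ∀ g → g ∈ S
          everywhere = second-neighbourhood-closed G connected non-bipartite (_∈ S) (_∈? S) g₁ S∋g₁ (closed no-N²)

      contradiction : ⊥
      contradiction = ¬¬-excluded-middle {A = ∃ N²} λ
        { (yes z∈N²) → no-extremal S h₀′ h₁ (extremal z∈N²)
        ; (no no-N²) → non-constant h₁ (constant no-N²) }

    long : ∀ j → ¬ ¬ Long j
    long zero    ¬long = ¬long (base , v ∷ [] , lift-base , (λ Y ()) , refl)
    long (suc j) ¬long = long j longer
      where
        longer : ¬ Long j
        longer ((g₁ , h₁) , s , lift , adm , len) =
          ¬¬-finite-∀ (n G) (λ g → Dec (LiftsTo (g , h₁) s)) (λ _ → ¬¬-excluded-middle)
            (MaximalLift.contradiction g₁ h₁ s lift adm (subst (λ m → ¬ Long m) (sym len) ¬long))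

    -- but admissible stacks are determined by their vertex, so only |V(G × H)| lengths occur
    not-all-long : ¬ (∀ (i : Fin (suc (n G * n H))) → Long (toℕ i))
    not-all-long long-at = distinct (pigeonhole (n<1+n (n G * n H)) code)
      where
        vertex : Fin (suc (n G * n H)) → Vt
        vertex i = proj₁ (long-at i)

        code : Fin (suc (n G * n H)) → Fin (n G * n H)
        code i = combine (proj₁ (vertex i)) (proj₂ (vertex i))

        distinct : (∃₂ λ i j → i < j × code i ≡ code j) → ⊥
        distinct (i , j , i<j , same) with long-at i | long-at j | combine-injective (proj₁ (vertex i)) (proj₂ (vertex i)) (proj₁ (vertex j)) (proj₂ (vertex j)) same
        ... | (y , s₁ , lift₁ , adm₁ , len₁) | (.y , s₂ , lift₂ , adm₂ , len₂) | refl , refl =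
          <-irrefl (suc-injective (trans (sym len₁) (trans (cong length (admissible-unique lift₁ lift₂ adm₁ adm₂)) len₂))) i<j

    obstruction : ⊥
    obstruction = ¬¬-finite-∀ _ (λ i → Long (toℕ i)) (λ i → long (toℕ i)) not-all-long

lemma18 : (G H K : Graph) (μ : V G × V H → V K) → IsHom G H K μ →
          SquareFree K → Connected G → Connected H →
          ¬ Bipartite G → ¬ Bipartite H →
          NoHExtremal G H K μ →
          (g₀ : V G) (h₀ : V H) (R : List (V K)) →
          InPi K (μ (g₀ , h₀)) R →
          (∀ C → ClosedWalkFrom (TensorE G H) (g₀ , h₀) C →
             ∃ λ (i : ℤ) → reduce (map μ C) ≡ pow (μ (g₀ , h₀)) R i) →
          (∀ h → ¬ (∀ g g' → μ (g , h) ≡ μ (g' , h))) →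
          CyclicallyReduced R
lemma18 G H K μ _ _ connected-G _ non-bipartite-G _ no-extremal g₀ h₀ R (closed , reduced) walks-to-powers non-constant =
  reduced , cyclic
  where
    v : V K
    v = μ (g₀ , h₀)

    cyclic : Reduced (R ++ drop 1 R)
    cyclic with reduced? _≟F_ (R ++ drop 1 R)
    ... | yes rr = rr
    ... | no ¬rr with conjugate-decomposition _≟F_ (E K) (edge-irreflexive K) v R closed reduced ¬rr
    ... | as , c , c₁ , M , cr , R≡ =
      ⊥-elim (Lifting.obstruction G H K μ g₀ h₀ R (firstStep as c) walks-to-powers flanked
                no-extremal non-constant connected-G non-bipartite-G)
      where
        flanked : ∀ i → Flanked v (firstStep as c) (pow v R i)
        flanked = subst (λ X → ∀ i → Flanked v (firstStep as c) (pow v X i)) (sym R≡)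
                    (Powers.conjugate-pow-flanked v as c c₁ M cr (subst Reduced R≡ reduced))
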